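{- Let $\mathcal I$ be a non-empty set with a directed preorder, let $n\in\mathbb N$ and let $\mathcal H_n\in\mathfrak D_n$. Then the family $\mathcal H_{\mathbb N}=(\mathcal H_m)_{m\in\mathbb N}$ generated by $\mathcal H_n$ is indefinitely large, and it satisfies: for all $m\in\mathbb N$, all $C\in\mathcal I^m$ and all $i\in\mathcal I$, if $Ci\in\mathcal H_{m+1}$ then $C\in\mathcal H_m$.
   Context: $\mathcal I$ is a non-empty set with a directed preorder $\le$. Write $\uparrow i=\{i'\in\mathcal I: i'\ge i\}$. Elements of $\mathcal I^n$ are contexts $C=(i_0,\dots,i_{n-1})$; $()$ is the empty context and $Ci$ is $C$ extended by $i$. The sets $\mathfrak D_n\subseteq\mathcal P(\mathcal I^n)$ are defined recursively: $\mathcal H\in\mathfrak D_0$ iff $\mathcal H=\{()\}$; $\mathcal H\in\mathfrak D_1$ iff $\uparrow i\subseteq\mathcal H$ for some $i\in\mathcal I$; for $\mathcal H\subseteq\mathcal I^{n+1}$, $\mathcal H\in\mathfrak D_{n+1}$ iff $d_n(\mathcal H)\in\mathfrak D_n$ where $d_n(\mathcal H)=\{C\in\mathcal I^n: C^{\mathcal H}\in\mathfrak D_1\}$ and $C^{\mathcal H}=\{i: Ci\in\mathcal H\}$. A family $(\mathcal H_m)_{m\in\mathbb N}$ with $\mathcal H_m\subseteq\mathcal I^m$ is indefinitely large iff $\mathcal H_m\in\mathfrak D_m$ for all $m$. The family generated by $\mathcal H_n\subseteq\mathcal I^n$: $\mathcal H_n$ itself at level $n$; for $m<n$, $(i_0,\dots,i_{m-1})\in\mathcal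 H_m$ iff there are $i_m,\dots,i_{n-1}$ with $(i_0,\dots,i_{n-1})\in\mathcal H_n$; for $m>n$, $\mathcal H_m=\mathcal H_n\times\mathcal I^{m-n}$. -}

module Defs where

open import Level using (Level; _⊔_) renaming (suc to lsuc)
open import Data.Nat using (ℕ; zero; suc; _+_; compare; less; equal; greater)
open import Data.Vec using (Vec; []; _∷_; _∷ʳ_; _++_)
open import Data.Product using (∃; _×_; _,_)
open import Relation.Binary.PropositionalEquality using (_≡_)
open import Relation.Binary.Structures using (IsPreorder)

record IsDirectedPreorder {a ℓ : Level} (I : Set a) (_≲_ : I → I → Set ℓ)
       : Set (a ⊔ ℓ) where
  field
    isPreorder : IsPreorder _≡_ _≲_
    directed   : ∀ i j → ∃ λ k → i ≲ k × j ≲ k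

module Contexts {a ℓ : Level} (I : Set a) (_≲_ : I → I → Set ℓ) where

  -- Contexts C ∈ I^n are vectors Vec I n; () is [], and Ci is C ∷ʳ i.
  -- A subset of I^n is a predicate on Vec I n.
  Subset : ℕ → Set (lsuc (a ⊔ ℓ))
  Subset n = Vec I n → Set (a ⊔ ℓ)

  ↑ : I → I → Set ℓ
  ↑ i i' = i ≲ i'

  fibre : {n : ℕ} → Subset (suc n) → Vec I n → I → Set (a ⊔ ℓ)
  fibre H C i = H (C ∷ʳ i)

  InD1 : (I → Set (a ⊔ ℓ)) → Set (a ⊔ ℓ)
  InD1 S = ∃ λ i → ∀ i' → ↑ i i' → S i'

  d : (n : ℕ) → Subset (suc n) → Subset n
  d n H C = InD1 (fibre H C)

  𝔇 : (n : ℕ) → Subset n → Set (a ⊔ ℓ)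
  𝔇 zero          H = H []                              -- H = {()}
  𝔇 (suc zero)    H = InD1 (λ i → H (i ∷ []))
  𝔇 (suc (suc n)) H = 𝔇 (suc n) (d (suc n) H)

  IndefinitelyLarge : ((m : ℕ) → Subset m) → Set (a ⊔ ℓ)
  IndefinitelyLarge H = ∀ m → 𝔇 m (H m)

  front : (n k : ℕ) → Vec I (suc (n + k)) → Vec I n
  front zero    k _       = []
  front (suc n) k (x ∷ C) = x ∷ front n k C

  extend : {m k : ℕ} → Vec I m → Vec I (suc k) → Vec I (suc (m + k))
  extend []      E = E
  extend (x ∷ C) E = x ∷ extend C E

  generated : (n : ℕ) → Subset n → (m : ℕ) → Subset m
  generated n H m C with compare m n
  ... | less .m k    = ∃ λ (E : Vec I (suc k)) → H (extend C E)
  ... | equal .m     = H C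
  ... | greater .n k = H (front n k C)

-- Below level n every level of the generated family is the projection of the
-- next one, and 𝔇 is preserved by projection: if C^G ⊇ ↑ j then Cj ∈ G by
-- reflexivity, so d(G) is contained in the projection.  Above level n every
-- level is the cylinder over the previous one, whose fibres are all of I and
-- hence lie in 𝔇₁ because I is non-empty.
module Submission where

open import Defs
open import Level using (Level)
open import Data.Nat using (ℕ; zero; suc; _+_; _∸_; _≤_; s≤s; compare; less; equal; greater)
open import Data.Nat.Properties using (≤-total; +-suc; m≤n+m; m∸n+n≡m)
open import Data.Vec using (Vec; []; _∷_; _∷ʳ_)
open import Data.Product using (∃; _×_; _,_)
open import Data.Sum using (inj₁; inj₂)
open import Relation.Binary.Definitions using (Reflexive)
open import Relation.Binary.PropositionalEquality using (_≡_; refl; subst; trans)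
open import Relation.Binary.Structures using (IsPreorder)

module Generated {a ℓ : Level} (I : Set a) (_≲_ : I → I → Set ℓ) where
  open Contexts I _≲_

  𝔇-suc⇒𝔇-d : ∀ n (H : Subset (suc n)) → 𝔇 (suc n) H → 𝔇 n (d n H)
  𝔇-suc⇒𝔇-d zero    H D = D
  𝔇-suc⇒𝔇-d (suc n) H D = D

  𝔇-d⇒𝔇-suc : ∀ n (H : Subset (suc n)) → 𝔇 n (d n H) → 𝔇 (suc n) H
  𝔇-d⇒𝔇-suc zero    H D = D
  𝔇-d⇒𝔇-suc (suc n) H D = D

  𝔇-mono : ∀ n {H H′ : Subset n} → (∀ C → H C → H′ C) → 𝔇 n H → 𝔇 n H′
  𝔇-mono zero    H⊆H′ D = H⊆H′ [] D
  𝔇-mono (suc n) {H} {H′} H⊆H′ D =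
    𝔇-d⇒𝔇-suc n H′ (𝔇-mono n d⊆d (𝔇-suc⇒𝔇-d n H D))
    where
    d⊆d : ∀ C → d n H C → d n H′ C
    d⊆d C (j , ↑j⊆) = j , λ i j≲i → H⊆H′ (C ∷ʳ i) (↑j⊆ i j≲i)

  𝔇-project : Reflexive _≲_ → ∀ m {G : Subset (suc m)} {G′ : Subset m}
            → (∀ C i → G (C ∷ʳ i) → G′ C) → 𝔇 (suc m) G → 𝔇 m G′
  𝔇-project ≲-refl m {G} proj D =
    𝔇-mono m (λ C (j , ↑j⊆) → proj C j (↑j⊆ j ≲-refl)) (𝔇-suc⇒𝔇-d m G D)

  𝔇-cylinder : I → ∀ m {G : Subset m} {G′ : Subset (suc m)}
             → (∀ C i → G C → G′ (C ∷ʳ i)) → 𝔇 m G → 𝔇 (suc m) G′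
  𝔇-cylinder i₀ m {G′ = G′} cyl D =
    𝔇-d⇒𝔇-suc m G′ (𝔇-mono m (λ C GC → i₀ , λ i _ → cyl C i GC) D)

  residual : ∀ {n} → Subset (suc n) → I → Subset n
  residual H x D = H (x ∷ D)

  generated-∷ : ∀ n (H : Subset (suc n)) m x (C : Vec I m)
              → generated (suc n) H (suc m) (x ∷ C) ≡ generated n (residual H x) m C
  generated-∷ n H m x C with compare m n
  ... | less _ _    = refl
  ... | equal _     = refl
  ... | greater _ _ = refl

  generated-zero : ∀ (H : Subset 0) m (C : Vec I m) → generated 0 H m C ≡ H []
  generated-zero H zero    [] = refl
  generated-zero H (suc m) C  = refl

  generated-[] : ∀ n (H : Subset n) → generated n H 0 [] → ∃ H
  generated-[] zero    H H[] = [] , H[]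
  generated-[] (suc n) H ∃E  = ∃E

  generated-self : ∀ n (H : Subset n) C → H C → generated n H n C
  generated-self zero    H []      HC = HC
  generated-self (suc n) H (x ∷ C) HC
    rewrite generated-∷ n H n x C = generated-self n (residual H x) C HC

  generated-init : ∀ n (H : Subset n) m (C : Vec I m) i
                 → generated n H (suc m) (C ∷ʳ i) → generated n H m C
  generated-init zero H m C i
    rewrite generated-zero H m C | generated-zero H (suc m) (C ∷ʳ i) = λ H[] → H[]
  generated-init (suc n) H zero [] i
    rewrite generated-∷ n H 0 i [] = λ G[] →
      let (E , HiE) = generated-[] n (residual H i) G[] in i ∷ E , HiE
  generated-init (suc n) H (suc m) (x ∷ C) i
    rewrite generated-∷ n H (suc m) x (C ∷ʳ i) | generated-∷ n H m x C =
      generated-init n (residual H x) m C i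

  generated-∷ʳ : ∀ n (H : Subset n) m (C : Vec I m) i → n ≤ m
               → generated n H m C → generated n H (suc m) (C ∷ʳ i)
  generated-∷ʳ zero H m C i _
    rewrite generated-zero H m C | generated-zero H (suc m) (C ∷ʳ i) = λ H[] → H[]
  generated-∷ʳ (suc n) H (suc m) (x ∷ C) i (s≤s n≤m)
    rewrite generated-∷ n H (suc m) x (C ∷ʳ i) | generated-∷ n H m x C =
      generated-∷ʳ n (residual H x) m C i n≤m

  𝔇-generated : Reflexive _≲_ → I → ∀ n (H : Subset n) → 𝔇 n H
              → IndefinitelyLarge (generated n H)
  𝔇-generated ≲-refl i₀ n H D m with ≤-total m n
  ... | inj₁ m≤n = below (n ∸ m) m (m∸n+n≡m m≤n)
    where
    below : ∀ k m → k + m ≡ n → 𝔇 m (generated n H m)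
    below zero    m refl = 𝔇-mono m (generated-self m H) D
    below (suc k) m k+m≡n =
      𝔇-project ≲-refl m (generated-init n H m) (below k (suc m) (trans (+-suc k m) k+m≡n))
  ... | inj₂ n≤m = subst (λ m → 𝔇 m (generated n H m)) (m∸n+n≡m n≤m) (above (m ∸ n))
    where
    above : ∀ k → 𝔇 (k + n) (generated n H (k + n))
    above zero    = 𝔇-mono n (generated-self n H) D
    above (suc k) =
      𝔇-cylinder i₀ (k + n) (λ C i → generated-∷ʳ n H (k + n) C i (m≤n+m n k)) (above k)

lemma2p4 : {a ℓ : Level} (I : Set a) (_≲_ : I → I → Set ℓ)
    → IsDirectedPreorder I _≲_ → I
    → (n : ℕ) (H : Contexts.Subset I _≲_ n) → Contexts.𝔇 I _≲_ n H
    → Contexts.IndefinitelyLarge I _≲_ (Contexts.generated I _≲_ n H)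
      × (∀ (m : ℕ) (C : Vec I m) (i : I)
           → Contexts.generated I _≲_ n H (suc m) (C ∷ʳ i)
           → Contexts.generated I _≲_ n H m C)
lemma2p4 I _≲_ directed i₀ n H D =
  𝔇-generated ≲-refl i₀ n H D , generated-init n H
  where
  open Generated I _≲_
  ≲-refl : Reflexive _≲_
  ≲-refl = IsPreorder.refl (IsDirectedPreorder.isPreorder directed)
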